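{- If $G\parallel\mathcal M\xrightarrow{\beta}G'\parallel\mathcal M'$ is a top transition (i.e. derived by rule Ext-Out or rule Ext-In) and $G\parallel\mathcal M$ is well formed, then $G'\parallel\mathcal M'$ is well formed.
   Context: Participants $p,q,r$; labels $\ell$. Processes: regular terms $P::=\bigoplus_{i\in I}q!\ell_i;P_i\mid\sum_{i\in I}q?\ell_i;P_i\mid\mathbf 0$ (coinductive, $I$ finite non-empty, pairwise distinct labels). A message is $(p,\ell,q)$; a queue $\mathcal M$ is a finite sequence of messages modulo the equivalence $\equiv$ allowing adjacent $(p,\ell,q),(r,\ell',s)$ to be swapped when $p\neq r$ or $q\neq s$. Global types: regular terms coinductively generated by $G::=\boxplus_{i\in I}pq!\ell_i;G_i\mid pq?\ell;G\mid\mathsf{End}$; an asynchronous type is $G\parallel\mathcal M$. Communications $pq!\ell$, $pq?\ell$ with $\mathrm{play}(pq!\ell)=\{p\}$, $\mathrm{play}(pq?\ell)=\{q\}$; $\mathrm{play}(G)$ least set with $\mathrm{play}(\boxplus_i pq!\ell_i;G_i)=\{p\}\cup\bigcup_i\mathrm{play}(G_i)$, $\mathrm{play}(pq?\ell;G)=\{q\}\cup\mathrm{play}(G)$, $\mathrm{play}(\mathsf{End})=\emptyset$; $\mathrm{Tr}(G)$ the sequences of communications on paths from root to an edge of $G$'s tree; $G$ cyclic if its tree contains itself as proper subtree. Projection $G\upharpoonright r$ (partial, coinductive; $\vec\pi$ possibly empty action sequence): $\mathbf 0$ if $r\notin\mathrm{play}(G)$; $(\boxplus_{i\in I}pq!\ell_i;G_i)\upharpoonright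 r$ is $\bigoplus_i q!\ell_i;(G_i\upharpoonright p)$ if $r=p$; $G_1\upharpoonright q$ if $r=q$, $I=\{1\}$; $\vec\pi;\sum_i p?\ell_i;P_i$ if $r=q$, $|I|>1$, $G_i\upharpoonright q=\vec\pi;p?\ell_i;P_i$ for all $i$; $G_1\upharpoonright r$ if $r\notin\{p,q\}$, $r\in\mathrm{play}(G_1)$, $G_i\upharpoonright r=G_1\upharpoonright r$ for all $i$; $(pq?\ell;G)\upharpoonright r$ is $p?\ell;(G\upharpoonright r)$ if $r=q$, $G\upharpoonright r$ if $r\neq q$, $r\in\mathrm{play}(G)$; undefined otherwise. Depth: $\mathrm{ord}(\tau,p)=n$ if $\tau=\tau_1\cdot\beta\cdot\tau_2$, $|\tau_1|=n-1$, $p\notin\mathrm{play}(\tau_1)$, $p\in\mathrm{play}(\beta)$, else $0$; $\mathrm{depth}(G,p)=\sup_{\tau\in\mathrm{Tr}(G)}\mathrm{ord}(\tau,p)$ if $p\in\mathrm{play}(G)$, else $0$; $G$ bounded if $\mathrm{depth}(G',p)<\infty$ for all subtrees $G'$ and all $p$. Balancing: $\vdash G\parallel\mathcal M$ if derivable by a possibly infinite derivation from: $\vdash\mathsf{End}\parallel\emptyset$; $\vdash G\parallel\mathcal M$ gives $\vdash pq?\ell;G\parallel(p,\ell,q)\cdot\mathcal M$; $\vdash G_i\parallel\mathcal M\cdot(p,\ell_i,q)$ for all $i\in I$ gives $\vdash\boxplus_{i\in I}pq!\ell_i;G_i\parallel\mathcal M$ provided $\mathcal M=\emptyset$ if that type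 is cyclic. $G\parallel\mathcal M$ is well formed if balanced, $G\upharpoonright p$ defined for all $p$, and $G$ bounded. The two top rules of the LTS of asynchronous types are (Ext-Out) $\boxplus_{i\in I}pq!\ell_i;G_i\parallel\mathcal M\xrightarrow{pq!\ell_k}G_k\parallel\mathcal M\cdot(p,\ell_k,q)$ for $k\in I$, and (Ext-In) $pq?\ell;G\parallel(p,\ell,q)\cdot\mathcal M\xrightarrow{pq?\ell}G\parallel\mathcal M$. -}

module Defs where

open import Data.Nat using (ℕ; zero; suc; _≤_; _<_)
open import Data.Nat.Properties using (_≟_)
open import Data.Product using (Σ; ∃; ∃-syntax; _×_; _,_; proj₁; proj₂)
open import Data.List using (List; []; _∷_; _++_; [_]; length; map)
open import Data.List.NonEmpty using (List⁺; _∷_; toList; head)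
open import Data.List.Membership.Propositional using (_∈_)
open import Data.List.Relation.Unary.Unique.Propositional using (Unique)
open import Data.List.Relation.Unary.AllPairs using ([]; _∷_)
open import Data.List.Relation.Binary.Pointwise using (Pointwise)
open import Data.List.Relation.Unary.All using ([])
open import Relation.Binary.Construct.Closure.ReflexiveTransitive using (Star)
open import Relation.Binary.PropositionalEquality using (_≡_; _≢_)
open import Relation.Nullary using (¬_; yes; no)
open import Data.Sum using (_⊎_)

Part : Set
Part = ℕ

Label : Set
Label = ℕ

Msg : Set
Msg = Part × Label × Part

Queue : Set
Queue = List Msg

data Swap : Queue → Queue → Set where
  here  : ∀ {p ℓ q r ℓ' s M} → (p ≢ r ⊎ q ≢ s) →
          Swap ((p , ℓ , q) ∷ (r , ℓ' , s) ∷ M) ((r , ℓ' , s) ∷ (p , ℓ , q) ∷ M)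
  there : ∀ {m M M'} → Swap M M' → Swap (m ∷ M) (m ∷ M')

-- the queue equivalence ≡ of the paper (Swap is symmetric)
_≈Q_ : Queue → Queue → Set
_≈Q_ = Star Swap

DistinctLabels : {A : Set} → List⁺ (Label × A) → Set
DistinctLabels bs = Unique (map proj₁ (toList bs))

single-distinct : {A : Set} (ℓ : Label) (x : A) → DistinctLabels ((ℓ , x) ∷ [])
single-distinct ℓ x = [] ∷ []

data Action : Set where
  _!_ : Part → Label → Action
  _??_ : Part → Label → Action

mutual
  record Proc : Set where
    coinductive
    constructor ⟪_⟫
    field pnode : PNode

  data PNode : Set where
    𝟘    : PNode
    send : (q : Part) (bs : List⁺ (Label × Proc)) → DistinctLabels bs → PNode
    recv : (q : Part) (bs : List⁺ (Label × Proc)) → DistinctLabels bs → PNode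

open Proc public

prefix : List Action → Proc → Proc
prefix [] P = P
prefix ((q ! ℓ) ∷ πs) P = ⟪ send q ((ℓ , prefix πs P) ∷ []) (single-distinct ℓ (prefix πs P)) ⟫
prefix ((q ?? ℓ) ∷ πs) P = ⟪ recv q ((ℓ , prefix πs P) ∷ []) (single-distinct ℓ (prefix πs P)) ⟫

-- bisimilarity (equality of coinductive process trees)
mutual
  record _≈P_ (P Q : Proc) : Set where
    coinductive
    field unfold : PNode≈ (pnode P) (pnode Q)

  data PNode≈ : PNode → PNode → Set where
    𝟘≈    : PNode≈ 𝟘 𝟘
    send≈ : ∀ {q bs u cs v} →
            Pointwise (λ b c → proj₁ b ≡ proj₁ c × proj₂ b ≈P proj₂ c) (toList bs) (toList cs) →
            PNode≈ (send q bs u) (send q cs v)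
    recv≈ : ∀ {q bs u cs v} →
            Pointwise (λ b c → proj₁ b ≡ proj₁ c × proj₂ b ≈P proj₂ c) (toList bs) (toList cs) →
            PNode≈ (recv q bs u) (recv q cs v)

mutual
  record Global : Set where
    coinductive
    field node : GNode

  data GNode : Set where
    End : GNode
    out : (p q : Part) (bs : List⁺ (Label × Global)) → DistinctLabels bs → GNode
    inp : (p q : Part) (ℓ : Label) → Global → GNode

open Global public

-- bisimilarity (equality of coinductive global type trees)
mutual
  record _≈G_ (G H : Global) : Set where
    coinductive
    field unfold : GNode≈ (node G) (node H)

  data GNode≈ : GNode → GNode → Set where
    End≈ : GNode≈ End End
    out≈ : ∀ {p q bs u cs v} →
           Pointwise (λ b c → proj₁ b ≡ proj₁ c × proj₂ b ≈G proj₂ c) (toList bs) (toList cs) →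
           GNode≈ (out p q bs u) (out p q cs v)
    inp≈ : ∀ {p q ℓ G H} → G ≈G H → GNode≈ (inp p q ℓ G) (inp p q ℓ H)

data Child : Global → Global → Set where
  child-out : ∀ {G p q bs u ℓ G'} → node G ≡ out p q bs u → (ℓ , G') ∈ toList bs → Child G G'
  child-inp : ∀ {G p q ℓ G'} → node G ≡ inp p q ℓ G' → Child G G'

Subtree : Global → Global → Set
Subtree G G' = Star Child G G'

ProperSubtree : Global → Global → Set
ProperSubtree G G' = ∃[ G₁ ] (Child G G₁ × Star Child G₁ G')

Cyclic : Global → Set
Cyclic G = ∃[ G' ] (ProperSubtree G G' × G' ≈G G)

Regular : Global → Set
Regular G = ∃[ Gs ] (∀ G' → Subtree G G' → ∃[ H ] (H ∈ Gs × G' ≈G H))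

data Comm : Set where
  snd : Part → Part → Label → Comm
  rcv : Part → Part → Label → Comm

playC : Comm → Part
playC (snd p q ℓ) = p
playC (rcv p q ℓ) = q

data Plays (r : Part) : Global → Set where
  pl-out   : ∀ {G q bs u} → node G ≡ out r q bs u → Plays r G
  pl-out'  : ∀ {G p q bs u ℓ G'} → node G ≡ out p q bs u → (ℓ , G') ∈ toList bs →
             Plays r G' → Plays r G
  pl-inp   : ∀ {G p ℓ G'} → node G ≡ inp p r ℓ G' → Plays r G
  pl-inp'  : ∀ {G p q ℓ G'} → node G ≡ inp p q ℓ G' → Plays r G' → Plays r G

data Trace : Global → List Comm → Set where
  tr-nil : ∀ {G} → Trace G []
  tr-out : ∀ {G p q bs u ℓ G' τ} → node G ≡ out p q bs u → (ℓ , G') ∈ toList bs →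
           Trace G' τ → Trace G (snd p q ℓ ∷ τ)
  tr-inp : ∀ {G p q ℓ G' τ} → node G ≡ inp p q ℓ G' →
           Trace G' τ → Trace G (rcv p q ℓ ∷ τ)

ord : List Comm → Part → ℕ
ord [] p = 0
ord (β ∷ τ) p with playC β ≟ p
... | yes _ = 1
... | no _ with ord τ p
...   | zero = 0
...   | suc n = suc (suc n)

FiniteDepth : Global → Part → Set
FiniteDepth G p = ∃[ n ] (∀ τ → Trace G τ → ord τ p ≤ n)

Bounded : Global → Set
Bounded G = ∀ G' → Subtree G G' → ∀ p → FiniteDepth G' p

mutual
  record Proj (G : Global) (r : Part) (P : Proc) : Set where
    coinductive
    field unfold : ProjN G r P

  data ProjN : Global → Part → Proc → Set where
    pj-zero   : ∀ {G r P} → ¬ Plays r G → pnode P ≡ 𝟘 → ProjN G r P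
    pj-send   : ∀ {G r P q bs u cs v} → node G ≡ out r q bs u →
                pnode P ≡ send q cs v →
                Pointwise (λ b c → proj₁ b ≡ proj₁ c × Proj (proj₂ b) r (proj₂ c))
                          (toList bs) (toList cs) →
                ProjN G r P
    pj-recv1  : ∀ {G r P p ℓ G₁ u} → node G ≡ out p r ((ℓ , G₁) ∷ []) u →
                r ≢ p → Plays r G → Proj G₁ r P → ProjN G r P
    pj-recvN  : ∀ {G r P p bs u} → node G ≡ out p r bs u →
                r ≢ p → Plays r G → 1 < length (toList bs) →
                (πs : List Action) (cs : List⁺ (Label × Proc)) (v : DistinctLabels cs) →
                Pointwise (λ b c → proj₁ b ≡ proj₁ c ×
                                   Proj (proj₂ b) r
                                        (prefix πs ⟪ recv p ((proj₁ c , proj₂ c) ∷ [])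
                                                         (single-distinct (proj₁ c) (proj₂ c)) ⟫))
                          (toList bs) (toList cs) →
                P ≈P prefix πs ⟪ recv p cs v ⟫ →
                ProjN G r P
    pj-other  : ∀ {G r P p q bs u} → node G ≡ out p q bs u →
                r ≢ p → r ≢ q → Plays r (proj₂ (head bs)) →
                (∀ {ℓ G'} → (ℓ , G') ∈ toList bs → Proj G' r P) →
                ProjN G r P
    pj-inp    : ∀ {G r P p ℓ G' P' v} → node G ≡ inp p r ℓ G' →
                pnode P ≡ recv p ((ℓ , P') ∷ []) v → Proj G' r P' → ProjN G r P
    pj-inp'   : ∀ {G r P p q ℓ G'} → node G ≡ inp p q ℓ G' →
                r ≢ q → Plays r G' → Proj G' r P → ProjN G r P

mutual
  record Balanced (G : Global) (M : Queue) : Set where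
    coinductive
    field unfold : BalancedN G M

  data BalancedN : Global → Queue → Set where
    bal-end : ∀ {G} → node G ≡ End → BalancedN G []
    bal-inp : ∀ {G M M' p q ℓ G'} → node G ≡ inp p q ℓ G' →
              M ≈Q ((p , ℓ , q) ∷ M') → Balanced G' M' → BalancedN G M
    bal-out : ∀ {G M p q bs u} → node G ≡ out p q bs u →
              -- premise for the class M·(p,ℓ,q): every representative of it
              (∀ {ℓ G'} → (ℓ , G') ∈ toList bs →
                 ∀ M'' → M'' ≈Q (M ++ [ (p , ℓ , q) ]) → Balanced G' M'') →
              (Cyclic G → M ≡ []) →
              BalancedN G M

WellFormed : Global → Queue → Set
WellFormed G M = Balanced G M × (∀ p → ∃[ P ] Proj G p P) × Bounded G

data TopStep : Global → Queue → Comm → Global → Queue → Set where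
  ext-out : ∀ {G M p q bs u ℓ G'} → node G ≡ out p q bs u → (ℓ , G') ∈ toList bs →
            TopStep G M (snd p q ℓ) G' (M ++ [ (p , ℓ , q) ])
  ext-in  : ∀ {G M M' p q ℓ G'} → node G ≡ inp p q ℓ G' → M ≈Q ((p , ℓ , q) ∷ M') →
            TopStep G M (rcv p q ℓ) G' M'

-- A top transition moves from G to an immediate subtree G' of G. Regularity, boundedness
-- and projectability pass to subtrees, and the balancing derivation of G ∥ M contains one
-- for G' ∥ M'. For Ext-In the latter holds only up to the queue equivalence, which needs
-- that x · A ≡ x · B implies A ≡ B: in any queue equivalent to x · A the first occurrence
-- of x is preceded only by messages that may be swapped with x.
module Submission where

open import Defs
open import Data.Product using (_×_; ∃-syntax; _,_; proj₂)
open import Data.List using ([]; _∷_; _++_; [_])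
open import Data.List.NonEmpty using (toList)
open import Data.List.Relation.Unary.Any using (here; there)
open import Data.List.Relation.Unary.All using (All; []; _∷_)
open import Data.List.Relation.Binary.Pointwise using (Pointwise; _∷_)
open import Data.List.Membership.Propositional using (_∈_)
open import Relation.Binary.Construct.Closure.ReflexiveTransitive
  using (ε; _◅_; _◅◅_; gmap; reverse)
open import Relation.Binary.PropositionalEquality using (_≡_; refl; sym; trans; subst; _≢_)
open import Relation.Nullary using (¬_)
open import Data.Sum using (_⊎_; inj₁; inj₂)
open import Data.Empty using (⊥-elim)

Independent : Msg → Msg → Set
Independent (p , _ , q) (r , _ , s) = p ≢ r ⊎ q ≢ s

Independent-irrefl : ∀ x → ¬ Independent x x
Independent-irrefl (p , ℓ , q) (inj₁ p≢p) = p≢p refl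
Independent-irrefl (p , ℓ , q) (inj₂ q≢q) = q≢q refl

Swap-sym : ∀ {M N} → Swap M N → Swap N M
Swap-sym (here (inj₁ p≢r)) = here (inj₁ (λ r≡p → p≢r (sym r≡p)))
Swap-sym (here (inj₂ q≢s)) = here (inj₂ (λ s≡q → q≢s (sym s≡q)))
Swap-sym (there s) = there (Swap-sym s)

≈Q-sym : ∀ {M N} → M ≈Q N → N ≈Q M
≈Q-sym = reverse Swap-sym

Swap-++⁺ʳ : ∀ {M N} L → Swap M N → Swap (M ++ L) (N ++ L)
Swap-++⁺ʳ L (here d) = here d
Swap-++⁺ʳ L (there s) = there (Swap-++⁺ʳ L s)

≈Q-++⁺ʳ : ∀ {M N} L → M ≈Q N → (M ++ L) ≈Q (N ++ L)
≈Q-++⁺ʳ L = gmap (_++ L) (Swap-++⁺ʳ L)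

≈Q-∷⁺ : ∀ {M N} m → M ≈Q N → (m ∷ M) ≈Q (m ∷ N)
≈Q-∷⁺ m = gmap (m ∷_) there

[]-≈Q : ∀ {N} → [] ≈Q N → N ≡ []
[]-≈Q ε = refl
[]-≈Q (() ◅ _)

-- The invariant of N ≈Q x ∷ A preserved by swaps: a first occurrence of x in N.
Splits : Msg → Queue → Queue → Set
Splits x A N = ∃[ N₁ ] ∃[ N₂ ] (N ≡ N₁ ++ x ∷ N₂ × All (Independent x) N₁ × A ≈Q (N₁ ++ N₂))

Splits-swap : ∀ {x N'} N₁ N₂ → All (Independent x) N₁ → Swap (N₁ ++ x ∷ N₂) N' →
              Splits x (N₁ ++ N₂) N'
Splits-swap [] (z ∷ N₂) [] (here x#z) = z ∷ [] , N₂ , refl , x#z ∷ [] , ε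
Splits-swap [] N₂ [] (there s) = [] , _ , refl , [] , s ◅ ε
Splits-swap (y ∷ []) N₂ (_ ∷ []) (here _) = [] , y ∷ N₂ , refl , [] , ε
Splits-swap (y ∷ w ∷ N₁) N₂ (x#y ∷ x#w ∷ x#N₁) (here y#w) =
  w ∷ y ∷ N₁ , N₂ , refl , x#w ∷ x#y ∷ x#N₁ , here y#w ◅ ε
Splits-swap (y ∷ N₁) N₂ (x#y ∷ x#N₁) (there s) with Splits-swap N₁ N₂ x#N₁ s
... | N₁' , N₂' , refl , x#N₁' , eq = y ∷ N₁' , N₂' , refl , x#y ∷ x#N₁' , ≈Q-∷⁺ y eq

Splits-≈Q : ∀ {x A N N'} → Splits x A N → N ≈Q N' → Splits x A N'
Splits-≈Q split ε = split
Splits-≈Q (N₁ , N₂ , refl , x#N₁ , eq) (s ◅ ss) with Splits-swap N₁ N₂ x#N₁ s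
... | N₁' , N₂' , refl , x#N₁' , eq' = Splits-≈Q (N₁' , N₂' , refl , x#N₁' , eq ◅◅ eq') ss

≈Q-∷-cancelˡ : ∀ {x A B} → (x ∷ A) ≈Q (x ∷ B) → A ≈Q B
≈Q-∷-cancelˡ {x} {A} eq with Splits-≈Q ([] , A , refl , [] , ε) eq
... | [] , _ , refl , _ , A≈B = A≈B
... | _ ∷ _ , _ , refl , x#x ∷ _ , _ = ⊥-elim (Independent-irrefl x x#x)

BalancedN-resp-≈Q : ∀ {G M N} → BalancedN G M → M ≈Q N → BalancedN G N
BalancedN-resp-≈Q (bal-end e) M≈N with []-≈Q M≈N
... | refl = bal-end e
BalancedN-resp-≈Q (bal-inp e M≈m∷M' b) M≈N = bal-inp e (≈Q-sym M≈N ◅◅ M≈m∷M') b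
BalancedN-resp-≈Q {N = N} (bal-out e branches acyclic) M≈N =
  bal-out e (λ ℓ∈ M'' M''≈ → branches ℓ∈ M'' (M''≈ ◅◅ ≈Q-++⁺ʳ _ (≈Q-sym M≈N)))
            (λ cyc → []-≈Q (subst (_≈Q N) (acyclic cyc) M≈N))

Balanced-resp-≈Q : ∀ {G M N} → Balanced G M → M ≈Q N → Balanced G N
Balanced-resp-≈Q b M≈N .Balanced.unfold = BalancedN-resp-≈Q (Balanced.unfold b) M≈N

Pointwise-lookupˡ : ∀ {A B : Set} {R : A → B → Set} {xs ys x} →
                    Pointwise R xs ys → x ∈ xs → ∃[ y ] R x y
Pointwise-lookupˡ (r ∷ _) (here refl) = _ , r
Pointwise-lookupˡ (_ ∷ rs) (there x∈xs) = Pointwise-lookupˡ rs x∈xs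

projectable-branch : ∀ {G p q bs u ℓ G' r P} → node G ≡ out p q bs u → (ℓ , G') ∈ toList bs →
                     ProjN G r P → ∃[ P' ] Proj G' r P'
projectable-branch {P = P} e ℓ∈ (pj-zero r∉G P≡𝟘) =
  P , record { unfold = pj-zero (λ r∈G' → r∉G (pl-out' e ℓ∈ r∈G')) P≡𝟘 }
projectable-branch e ℓ∈ (pj-send e' _ pw) with trans (sym e) e'
... | refl with Pointwise-lookupˡ pw ℓ∈
...   | _ , _ , proj = _ , proj
projectable-branch e ℓ∈ (pj-recv1 e' _ _ proj) with trans (sym e) e' | ℓ∈
... | refl | here refl = _ , proj
... | refl | there ()
projectable-branch e ℓ∈ (pj-recvN e' _ _ _ _ _ _ pw _) with trans (sym e) e'
... | refl with Pointwise-lookupˡ pw ℓ∈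
...   | _ , _ , proj = _ , proj
projectable-branch e ℓ∈ (pj-other e' _ _ _ projs) with trans (sym e) e'
... | refl = _ , projs ℓ∈
projectable-branch e ℓ∈ (pj-inp e' _ _) with trans (sym e) e'
... | ()
projectable-branch e ℓ∈ (pj-inp' e' _ _ _) with trans (sym e) e'
... | ()

projectable-continuation : ∀ {G p q ℓ G' r P} → node G ≡ inp p q ℓ G' →
                           ProjN G r P → ∃[ P' ] Proj G' r P'
projectable-continuation {P = P} e (pj-zero r∉G P≡𝟘) =
  P , record { unfold = pj-zero (λ r∈G' → r∉G (pl-inp' e r∈G')) P≡𝟘 }
projectable-continuation e (pj-inp e' _ proj) with trans (sym e) e'
... | refl = _ , proj
projectable-continuation e (pj-inp' e' _ _ proj) with trans (sym e) e'
... | refl = _ , proj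
projectable-continuation e (pj-send e' _ _) with trans (sym e) e'
... | ()
projectable-continuation e (pj-recv1 e' _ _ _) with trans (sym e) e'
... | ()
projectable-continuation e (pj-recvN e' _ _ _ _ _ _ _ _) with trans (sym e) e'
... | ()
projectable-continuation e (pj-other e' _ _ _ _) with trans (sym e) e'
... | ()

projectable-subtree : ∀ {G G' r P} → Subtree G G' → Proj G r P → ∃[ P' ] Proj G' r P'
projectable-subtree ε proj = _ , proj
projectable-subtree (child-out e ℓ∈ ◅ s) proj =
  projectable-subtree s (proj₂ (projectable-branch e ℓ∈ (Proj.unfold proj)))
projectable-subtree (child-inp e ◅ s) proj =
  projectable-subtree s (proj₂ (projectable-continuation e (Proj.unfold proj)))

Regular-subtree : ∀ {G G'} → Subtree G G' → Regular G → Regular G'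
Regular-subtree G⊒G' (Gs , finite) = Gs , λ H G'⊒H → finite H (G⊒G' ◅◅ G'⊒H)

Bounded-subtree : ∀ {G G'} → Subtree G G' → Bounded G → Bounded G'
Bounded-subtree G⊒G' bounded H G'⊒H = bounded H (G⊒G' ◅◅ G'⊒H)

TopStep-child : ∀ {G M β G' M'} → TopStep G M β G' M' → Child G G'
TopStep-child (ext-out e ℓ∈) = child-out e ℓ∈
TopStep-child (ext-in e _) = child-inp e

balanced-out : ∀ {G M p q bs u ℓ G'} → node G ≡ out p q bs u → (ℓ , G') ∈ toList bs →
               BalancedN G M → Balanced G' (M ++ [ (p , ℓ , q) ])
balanced-out e ℓ∈ (bal-out e' branches _) with trans (sym e) e'
... | refl = branches ℓ∈ _ ε
balanced-out e ℓ∈ (bal-end e') with trans (sym e) e'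
... | ()
balanced-out e ℓ∈ (bal-inp e' _ _) with trans (sym e) e'
... | ()

balanced-inp : ∀ {G M M' p q ℓ G'} → node G ≡ inp p q ℓ G' → M ≈Q ((p , ℓ , q) ∷ M') →
               BalancedN G M → Balanced G' M'
balanced-inp e M≈m∷M' (bal-inp e' M≈m∷M'' b) with trans (sym e) e'
... | refl = Balanced-resp-≈Q b (≈Q-∷-cancelˡ (≈Q-sym M≈m∷M'' ◅◅ M≈m∷M'))
balanced-inp e _ (bal-end e') with trans (sym e) e'
... | ()
balanced-inp e _ (bal-out e' _ _) with trans (sym e) e'
... | ()

Balanced-step : ∀ {G M β G' M'} → TopStep G M β G' M' → Balanced G M → Balanced G' M'
Balanced-step (ext-out e ℓ∈) b = balanced-out e ℓ∈ (Balanced.unfold b)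
Balanced-step (ext-in e M≈m∷M') b = balanced-inp e M≈m∷M' (Balanced.unfold b)

lemma3p9 : ∀ {G M β G' M'} → Regular G → TopStep G M β G' M' →
             WellFormed G M → Regular G' × WellFormed G' M'
lemma3p9 {G} {G' = G'} regular step (balanced , projectable , bounded) =
  Regular-subtree G⊒G' regular ,
  Balanced-step step balanced ,
  (λ r → projectable-subtree G⊒G' (proj₂ (projectable r))) ,
  Bounded-subtree G⊒G' bounded
  where
  G⊒G' : Subtree G G'
  G⊒G' = TopStep-child step ◅ ε
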